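{- Let $S$ be a subset of a real vector space with $0\in S$ and $-S=S$, and let $g$ and $g_i$ ($1\le i\le j$) be odd functions from $S$ into itself (i.e. $g(-x)=-g(x)$) such that, for every positive integer $n$, the equations $g^n(x)=-x$ and $g_i^n(x)=-x$ have finitely many solutions in $S$. Then: (a) For any fixed odd integer $k>0$, letting $\psi_k(n)=\psi_g(kn)$, we have $\Phi_2(\psi_k,n)\equiv 0\pmod{2n}$ for all positive integers $n$. (b) Letting $(\prod_{i=1}^j\psi_{g_i})(n)=\prod_{i=1}^j\psi_{g_i}(n)$, we have $\Phi_2(\prod_{i=1}^j\psi_{g_i},n)\equiv 0\pmod{2n}$ for all positive integers $n$.
   Context: $g^n$ denotes the $n$-th iterate of $g$. For an odd map $h:S\to S$, $\psi_h(n)$ denotes the number of distinct solutions $x\in S$ of $h^n(x)=-x$. For an integer-valued function $\phi$ on the positive integers: if $n=2^{k_0}p_1^{k_1}\cdots p_r^{k_r}$ with distinct odd primes $p_i$, $k_0\ge 0$, $r\ge1$, $k_i\ge1$, then $\Phi_2(\phi,n)=\phi(n)-\sum_i\phi(n/p_i)+\sum_{i_1<i_2}\phi(n/(p_{i_1}p_{i_2}))-\cdots+(-1)^r\phi(n/(p_1\cdots p_r))$; if $n=2^k$ with $k\ge0$, then $\Phi_2(\phi,n)=\phi(n)-1$. -}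

module Defs where

open import Level using (Level; _⊔_) renaming (suc to lsuc)
open import Data.Bool using (Bool; true; false; _∧_; if_then_else_)
open import Data.Nat as ℕ using (ℕ; zero; suc; _%_; _≡ᵇ_)
open import Data.Nat.DivMod using (_/_)
open import Data.Nat.Divisibility using (_∣?_)
open import Data.Nat.Primality using (prime?)
open import Data.Integer as ℤ using (ℤ; +_; -_)
open import Data.List using (List; []; _∷_; _++_; length; filterᵇ; upTo; map; foldr)
open import Data.Nat.ListAction using (product)
open import Data.List.Membership.Propositional using (_∈_)
open import Data.List.Relation.Unary.Unique.Propositional using (Unique)
open import Data.Product using (_×_)
open import Function using (id; _∘_; _⇔_)
open import Relation.Nullary using (does)
open import Relation.Binary.PropositionalEquality using (_≡_)
open import Algebra.Structures using (IsAbelianGroup)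

iter : ∀ {a} {A : Set a} → (A → A) → ℕ → A → A
iter g zero    = id
iter g (suc n) = g ∘ iter g n

-- The ambient "vector space" V (only its additive group is used) and a
-- subset S ⊆ V with 0 ∈ S and -S = S, presented as a type S with an
-- injective embedding into V compatible with 0 and negation.

record SymmetricSubset (a b : Level) : Set (lsuc (a ⊔ b)) where
  field
    V       : Set a
    _+V_    : V → V → V
    0V      : V
    -V_     : V → V
    isAbGrp : IsAbelianGroup _≡_ _+V_ 0V -V_
    -- in a real vector space, x + x = 0 forces x = 0
    2-torsion-free : ∀ x → x +V x ≡ 0V → x ≡ 0V
    S       : Set b
    ι       : S → V
    ι-inj   : ∀ {x y} → ι x ≡ ι y → x ≡ y
    0S      : S
    ι-0     : ι 0S ≡ 0V
    negS    : S → S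
    ι-neg   : ∀ x → ι (negS x) ≡ -V (ι x)

module _ {a b} (Σ𝕊 : SymmetricSubset a b) where
  open SymmetricSubset Σ𝕊

  Odd : (S → S) → Set b
  Odd h = ∀ x → h (negS x) ≡ negS (h x)

  record Solutions (h : S → S) (n : ℕ) : Set b where
    field
      sols     : List S
      unique   : Unique sols
      complete : ∀ x → (x ∈ sols ⇔ (iter h n x ≡ negS x))

  FinitelyManySolutions : (S → S) → Set b
  FinitelyManySolutions h = ∀ n → 1 ℕ.≤ n → Solutions h n

  -- ψ_h(n) = number of distinct solutions (for n ≥ 1; 0 at n = 0, unused)
  ψ : (h : S → S) → FinitelyManySolutions h → ℕ → ℕ
  ψ h fin zero    = 0
  ψ h fin (suc n) = length (Solutions.sols (fin (suc n) (ℕ.s≤s ℕ.z≤n)))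

oddPrimeDivisors : ℕ → List ℕ
oddPrimeDivisors n =
  filterᵇ (λ p → does (prime? p) ∧ (p % 2 ≡ᵇ 1) ∧ does (p ∣? n)) (upTo (suc n))

subsets : ∀ {a} {A : Set a} → List A → List (List A)
subsets []       = [] ∷ []
subsets (x ∷ xs) = subsets xs ++ map (x ∷_) (subsets xs)

quot : ℕ → ℕ → ℕ
quot n zero    = 0
quot n (suc d) = n / suc d

sign : ℕ → ℤ
sign zero    = + 1
sign (suc k) = - sign k

sumℤ : List ℤ → ℤ
sumℤ = foldr ℤ._+_ (+ 0)

Φ₂ : (ℕ → ℤ) → ℕ → ℤ
Φ₂ φ n with oddPrimeDivisors n
... | []        = φ n ℤ.- + 1
... | ps@(_ ∷ _) =
  sumℤ (map (λ T → sign (length T) ℤ.* φ (quot n (product T))) (subsets ps))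

IsOdd : ℕ → Set
IsOdd k = k % 2 ≡ 1

module Submission where

-- Restricted to the finite set of solutions of h^n(x) = -x, an odd map h becomes a permutation σ
-- with σ^n = τ, where τ is negation, an involution whose only fixed point is 0. For m ∣ n with n/m
-- odd, ψ(m) counts the points with σ^m x = τ x, and for coprime odd a, b a point satisfies this for m
-- iff it does for m a and for m b. By inclusion–exclusion over the odd primes p ∣ n, Φ₂(ψ, n) is
-- therefore the number of points x ≠ 0 with σ^(n/p) x ≠ τ x for every such p (for n a power of 2
-- this is ψ(n) - 1). On these points σ has exact period 2n, so 2n divides their number.
-- Part (a) is the case h = g^k and part (b) the case of the map (g₁, …, g_j) on S^j.

open import Level using (Level) renaming (suc to lsuc)
open import Function using (_∘_; _⇔_; Injective; id)
open import Function.Bundles using (mk⇔; module Equivalence)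
open import Relation.Binary.PropositionalEquality
open import Relation.Binary.Definitions using (tri<; tri≈; tri>)
open import Relation.Nullary using (¬_; contradiction; Dec)
open import Relation.Nullary.Decidable using (does; yes; no; dec-true; dec-false; does-⇔; _×-dec_)
open import Induction.WellFounded using (Acc; acc)
open import Algebra.Bundles using (Group)
open import Algebra.Structures using (IsAbelianGroup)
import Algebra.Properties.Group as GroupProperties
import Algebra.Properties.CommutativeMonoid.Sum as Sum
open import Data.Empty using (⊥; ⊥-elim)
open import Data.Product using (∃-syntax; _×_; _,_; proj₁; proj₂)
open import Data.Sum using (_⊎_; inj₁; inj₂; [_,_]′)
import Data.Bool as Bool
open import Data.Bool using (Bool; true; false; not; _∧_; T?)
open import Data.Bool.Properties using (¬-not; ∧-zeroʳ; ∧-identityʳ; T-∧; T-≡)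
open import Data.Bool.ListAction using (all; and)
open import Data.Nat as ℕ
  using (ℕ; zero; suc; _+_; _*_; _∸_; pred; _≤_; _<_; z≤n; s≤s; _%_; _/_; NonZero; >-nonZero)
import Data.Nat.Properties as ℕₚ
open import Data.Nat.Induction using (<-wellFounded)
open import Data.Nat.DivMod using (n/1≡n; m≡m%n+[m/n]*n; %-distribˡ-*; m%n<n; m*n/n≡m; _divMod_; result)
open import Data.Nat.Divisibility as ℕ∣
  using (divides; _∣?_; ∣-trans; _∣0; ∣-refl; ∣m∣n⇒∣m+n; m%n≡0⇒n∣m; n∣m⇒m%n≡0; ∣⇒≤)
  renaming (_∣_ to _∣ℕ_)
open import Data.Nat.GCD using (module Bézout; module GCD)
open import Data.Nat.Coprimality as Coprimality using (Coprime; coprime-divisor; coprime-Bézout)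
open import Data.Nat.Primality using (Prime; prime?; prime[2]; prime⇒irreducible; prime⇒nonZero; productOfPrimes≢0)
open import Data.Nat.Primality.Factorisation using (factorise; factorisationHasAllPrimeFactors)
open import Data.Nat.ListAction using (product)
open import Data.Nat.Tactic.RingSolver using (solve-∀)
open import Data.Integer as ℤ using (ℤ; +_; -_; _-_; 1ℤ)
import Data.Integer.Properties as ℤₚ
open import Data.Integer.Divisibility using (_∣_)
import Data.Integer.Tactic.RingSolver as ℤ-Solver
open import Algebra.Properties.Semiring.Sum ℤₚ.+-*-semiring using (*-distribˡ-sum)
open import Data.Fin using (Fin; zero; suc; _≟_; toℕ)
open import Data.Fin.Properties using (any?; toℕ-injective; toℕ<n)
open import Data.List as List
  using (List; []; _∷_; _++_; map; length; lookup; tabulate; allFin; upTo; cartesianProductWith)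
open import Data.List.Properties using (map-++; map-∘; map-cong; map-cong-local; length-++; length-map; map-tabulate)
open import Data.List.Membership.Propositional using (_∈_; _∉_)
import Data.List.Membership.Propositional.Properties as ∈ₚ
open import Data.List.Relation.Unary.All as All using (All; []; _∷_)
import Data.List.Relation.Unary.All.Properties as Allₚ
open import Data.List.Relation.Unary.Any as Any using (here; there)
open import Data.List.Relation.Unary.Any.Properties using (lookup-index)
open import Data.List.Relation.Unary.AllPairs using ([]; _∷_)
open import Data.List.Relation.Unary.Unique.Propositional using (Unique)
import Data.List.Relation.Unary.Unique.Propositional.Properties as Uniqueₚ
open import Data.Vec as Vec using (Vec)
import Data.Vec.Properties as Vecₚ

open import Defs

open ≡-Reasoning

variable
  a : Level
  A : Set a

-- Iteration

Commute : (A → A) → (A → A) → Set _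
Commute f g = ∀ x → f (g x) ≡ g (f x)

iter-+ : ∀ (f : A → A) m n x → iter f (m + n) x ≡ iter f m (iter f n x)
iter-+ f zero    n x = refl
iter-+ f (suc m) n x = cong f (iter-+ f m n x)

iter-* : ∀ (f : A → A) m n x → iter f (m * n) x ≡ iter (iter f n) m x
iter-* f zero    n x = refl
iter-* f (suc m) n x = trans (iter-+ f n (m * n) x) (cong (iter f n) (iter-* f m n x))

iter-commute : ∀ (f : A → A) {g} → Commute f g → ∀ n → Commute (iter f n) g
iter-commute f     c zero    x = refl
iter-commute f {g} c (suc n) x = trans (cong f (iter-commute f {g} c n x)) (c _)

iter-fixed : ∀ (f : A → A) {x} → f x ≡ x → ∀ n → iter f n x ≡ x
iter-fixed f fx zero    = refl
iter-fixed f fx (suc n) = trans (cong f (iter-fixed f fx n)) fx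

iter-periodic : ∀ (f : A → A) {p x} → iter f p x ≡ x → ∀ k → iter f (k * p) x ≡ x
iter-periodic f {p} {x} fx k = trans (iter-* f k p x) (iter-fixed (iter f p) fx k)

NoShorterPeriod : (A → A) → ℕ → A → Set _
NoShorterPeriod f M x = ∀ t → 0 < t → t < M → iter f t x ≢ x

iter-Bézout : ∀ (f : A → A) {d m n x} → Bézout.Identity d m n →
              iter f m x ≡ x → iter f n x ≡ x → iter f d x ≡ x
iter-Bézout f {d} {m} {n} {x} (Bézout.+- k l eq) fm fn = begin
  iter f d x                  ≡⟨ cong (iter f d) (iter-periodic f fn l) ⟨
  iter f d (iter f (l * n) x) ≡⟨ iter-+ f d (l * n) x ⟨
  iter f (d + l * n) x        ≡⟨ cong (λ t → iter f t x) eq ⟩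
  iter f (k * m) x            ≡⟨ iter-periodic f fm k ⟩
  x                           ∎
iter-Bézout f (Bézout.-+ k l eq) fm fn = iter-Bézout f (Bézout.+- l k eq) fn fm

odd⇒≡1+2k : ∀ {p} → IsOdd p → p ≡ suc (p / 2 * 2)
odd⇒≡1+2k {p} odd = trans (m≡m%n+[m/n]*n p 2) (cong (_+ p / 2 * 2) odd)

iter-odd-multiple : ∀ (f : A → A) m p {x} → iter f (2 * m) x ≡ x → IsOdd p →
                    iter f (m * p) x ≡ iter f m x
iter-odd-multiple f m p {x} per odd = begin
  iter f (m * p) x                        ≡⟨ cong (λ t → iter f t x) m*p≡m+k*2m ⟩
  iter f (m + p / 2 * (2 * m)) x          ≡⟨ iter-+ f m _ x ⟩
  iter f m (iter f (p / 2 * (2 * m)) x)   ≡⟨ cong (iter f m) (iter-periodic f per (p / 2)) ⟩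
  iter f m x                              ∎
  where
  m*p≡m+k*2m : m * p ≡ m + p / 2 * (2 * m)
  m*p≡m+k*2m = trans (cong (m *_) (odd⇒≡1+2k odd)) (distrib m (p / 2))
    where
    distrib : ∀ m k → m * suc (k * 2) ≡ m + k * (2 * m)
    distrib = solve-∀

iter-invariant : ∀ {b} {B : Set b} {σ : A → A} (P : A → B) → (∀ i → P (σ i) ≡ P i) →
                 ∀ t i → P (iter σ t i) ≡ P i
iter-invariant P P-inv zero    i = refl
iter-invariant P P-inv (suc t) i = trans (P-inv _) (iter-invariant P P-inv t i)

iter-pred-inverse : ∀ (σ : A → A) M .⦃ _ : NonZero M ⦄ → (∀ i → iter σ M i ≡ i) →
                    ∀ j → iter σ (pred M) (σ j) ≡ j
iter-pred-inverse σ M σᴹ≡id j = begin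
  iter σ (pred M) (σ j)    ≡⟨ iter-commute σ {σ} (λ _ → refl) (pred M) j ⟩
  iter σ (suc (pred M)) j  ≡⟨ cong (λ s → iter σ s j) (ℕₚ.suc-pred M) ⟩
  iter σ M j               ≡⟨ σᴹ≡id j ⟩
  j                        ∎

periodic⇒injective : ∀ (σ : A → A) M .⦃ _ : NonZero M ⦄ → (∀ i → iter σ M i ≡ i) →
                     Injective _≡_ _≡_ σ
periodic⇒injective σ M σᴹ≡id {i} {j} σi≡σj = begin
  i                      ≡⟨ iter-pred-inverse σ M σᴹ≡id i ⟨
  iter σ (pred M) (σ i)  ≡⟨ cong (iter σ (pred M)) σi≡σj ⟩
  iter σ (pred M) (σ j)  ≡⟨ iter-pred-inverse σ M σᴹ≡id j ⟩
  j                      ∎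

-- Parity and divisors

parity : ∀ n → n % 2 ≡ 0 ⊎ IsOdd n
parity n with n % 2 | m%n<n n 2
... | 0           | _ = inj₁ refl
... | 1           | _ = inj₂ refl
... | suc (suc _) | s≤s (s≤s ())

odd-* : ∀ {m n} → IsOdd m → IsOdd n → IsOdd (m * n)
odd-* {m} {n} om on = trans (%-distribˡ-* m n 2) (cong₂ (λ i j → (i * j) % 2) om on)

odd-product : ∀ {ns} → All IsOdd ns → IsOdd (product ns)
odd-product {[]}     []         = refl
odd-product {n ∷ ns} (on ∷ ons) = odd-* {n} on (odd-product ons)

odd-∣ : ∀ {d n} → d ∣ℕ n → IsOdd n → IsOdd d
odd-∣ {d} {n} d∣n odd with parity d
... | inj₂ od   = od
... | inj₁ even = contradiction (trans (sym n%2≡0) odd) λ ()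
  where
  n%2≡0 : n % 2 ≡ 0
  n%2≡0 = n∣m⇒m%n≡0 n 2 (∣-trans (m%n≡0⇒n∣m d 2 even) d∣n)

odd⇒coprime-2 : ∀ {p} → IsOdd p → Coprime p 2
odd⇒coprime-2 odd (d∣p , d∣2) with prime⇒irreducible prime[2] d∣2
... | inj₁ d≡1 = d≡1
... | inj₂ refl = contradiction (odd-∣ d∣p odd) λ ()

prime-divisor : ∀ n → 2 ≤ n → ∃[ p ] Prime p × p ∣ℕ n
prime-divisor (suc zero)      (s≤s ())
prime-divisor n@(suc (suc _)) _ with factorise n
... | record { factors = [] ; isFactorisation = () }
... | record { factors = p ∷ ps ; isFactorisation = n≡ ; factorsPrime = p-prime ∷ _ } =
  p , p-prime , divides (product ps) (trans n≡ (ℕₚ.*-comm p (product ps)))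

even-cofactor : ∀ {c d n} → 2 * n ≡ c * d → c % 2 ≡ 0 → d ∣ℕ n
even-cofactor {c} {d} {n} 2n≡cd c-even = divides (c / 2) (ℕₚ.*-cancelˡ-≡ n (c / 2 * d) 2 (begin
  2 * n           ≡⟨ 2n≡cd ⟩
  c * d           ≡⟨ cong (_* d) (trans (m≡m%n+[m/n]*n c 2) (cong (_+ c / 2 * 2) c-even)) ⟩
  c / 2 * 2 * d   ≡⟨ rearrange (c / 2) d ⟩
  2 * (c / 2 * d) ∎))
  where
  rearrange : ∀ k d → k * 2 * d ≡ 2 * (k * d)
  rearrange = solve-∀

odd-cofactor : ∀ {c d n} → 2 * n ≡ c * d → IsOdd c → 2 ≤ c →
               ∃[ p ] ∃[ m ] Prime p × IsOdd p × n ≡ m * p × d ∣ℕ 2 * m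
odd-cofactor {c} {d} {n} 2n≡cd c-odd 2≤c with prime-divisor c 2≤c
... | p , p-prime , p∣c@(divides r c≡rp)
    with coprime-divisor (odd⇒coprime-2 (odd-∣ p∣c c-odd))
                         (∣-trans p∣c (divides d (trans 2n≡cd (ℕₚ.*-comm c d))))
...   | divides m n≡mp = p , m , p-prime , odd-∣ p∣c c-odd , n≡mp ,
  divides r (ℕₚ.*-cancelʳ-≡ (2 * m) (r * d) p ⦃ prime⇒nonZero p-prime ⦄ (begin
    2 * m * p   ≡⟨ ℕₚ.*-assoc 2 m p ⟩
    2 * (m * p) ≡⟨ cong (2 *_) n≡mp ⟨
    2 * n       ≡⟨ 2n≡cd ⟩
    c * d       ≡⟨ cong (_* d) c≡rp ⟩
    r * p * d   ≡⟨ swap r p d ⟩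
    r * d * p   ∎))
  where
  swap : ∀ r p d → r * p * d ≡ r * d * p
  swap = solve-∀

divisor-of-double : ∀ {d n} → d ∣ℕ 2 * n → d < 2 * n →
                    d ∣ℕ n ⊎ ∃[ p ] ∃[ m ] Prime p × IsOdd p × n ≡ m * p × d ∣ℕ 2 * m
divisor-of-double {d} {n} (divides c 2n≡cd) d<2n with parity c
... | inj₁ c-even = inj₁ (even-cofactor {c} 2n≡cd c-even)
... | inj₂ c-odd  = inj₂ (odd-cofactor {c} 2n≡cd c-odd (2≤c c 2n≡cd))
  where
  2≤c : ∀ c → 2 * n ≡ c * d → 2 ≤ c
  2≤c zero          2n≡0 = contradiction 2n≡0 (ℕₚ.m<n⇒n≢0 d<2n)
  2≤c (suc zero)    2n≡d = contradiction (trans 2n≡d (ℕₚ.+-identityʳ d)) (ℕₚ.<⇒≢ d<2n ∘ sym)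
  2≤c (suc (suc _)) _    = s≤s (s≤s z≤n)

prime∉⇒coprime-product : ∀ {p ps} → Prime p → All Prime ps → p ∉ ps → Coprime p (product ps)
prime∉⇒coprime-product p-prime ps-prime p∉ps (d∣p , d∣∏) with prime⇒irreducible p-prime d∣p
... | inj₁ d≡1  = d≡1
... | inj₂ refl = contradiction (factorisationHasAllPrimeFactors p-prime d∣∏ ps-prime) p∉ps

coprime⇒*-∣ : ∀ {m n o} → Coprime m n → m ∣ℕ o → n ∣ℕ o → m * n ∣ℕ o
coprime⇒*-∣ {m} {n} c m∣o (divides k refl) with coprime-divisor c (subst (m ∣ℕ_) (ℕₚ.*-comm k n) m∣o)
... | divides l refl = divides l (ℕₚ.*-assoc l m n)

product-∣ : ∀ {ps n} → Unique ps → All Prime ps → All (_∣ℕ n) ps → product ps ∣ℕ n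
product-∣ []         []                []              = ℕ∣.1∣ _
product-∣ (p∉ps ∷ u) (p-prime ∷ primes) (p∣n ∷ ps∣n) =
  coprime⇒*-∣ (prime∉⇒coprime-product p-prime primes (Allₚ.All¬⇒¬Any p∉ps))
              p∣n (product-∣ u primes ps∣n)

quot-exact : ∀ {n} q d .⦃ _ : NonZero d ⦄ → n ≡ q * d → quot n d ≡ q
quot-exact q (suc d) refl = m*n/n≡m q (suc d)

-- Antiperiodic points

Antiperiodic : (f ν : A → A) → ℕ → A → Set _
Antiperiodic f ν m x = iter f m x ≡ ν x

module Antiperiodicity {A : Set a} (f ν : A → A)
                       (ν-involutive : ∀ x → ν (ν x) ≡ x) (f-ν-commute : Commute f ν) where

  antiperiodic⇒periodic : ∀ m {x} → Antiperiodic f ν m x → iter f (2 * m) x ≡ x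
  antiperiodic⇒periodic m {x} fᵐx≡νx = begin
    iter f (2 * m) x      ≡⟨ cong (λ t → iter f (m + t) x) (ℕₚ.+-identityʳ m) ⟩
    iter f (m + m) x      ≡⟨ iter-+ f m m x ⟩
    iter f m (iter f m x) ≡⟨ cong (iter f m) fᵐx≡νx ⟩
    iter f m (ν x)        ≡⟨ iter-commute f f-ν-commute m x ⟩
    ν (iter f m x)        ≡⟨ cong ν fᵐx≡νx ⟩
    ν (ν x)               ≡⟨ ν-involutive x ⟩
    x                     ∎

  antiperiodic-*-odd : ∀ m p {x} → IsOdd p → Antiperiodic f ν m x → Antiperiodic f ν (m * p) x
  antiperiodic-*-odd m p odd ap = trans (iter-odd-multiple f m p (antiperiodic⇒periodic m ap) odd) ap

  antiperiodic-/-odd : ∀ m p {x} → iter f (2 * m) x ≡ x → IsOdd p →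
                       Antiperiodic f ν (m * p) x → Antiperiodic f ν m x
  antiperiodic-/-odd m p per odd ap = trans (sym (iter-odd-multiple f m p per odd)) ap

  antiperiodic-coprime : ∀ m p q {x} → IsOdd p → Coprime p q →
                         Antiperiodic f ν (m * p) x → Antiperiodic f ν (m * q) x → Antiperiodic f ν m x
  antiperiodic-coprime m p q {x} odd coprime apₚ ap_q =
    antiperiodic-/-odd m p (iter-Bézout (iter f (2 * m)) (coprime-Bézout coprime) (fixed apₚ) (fixed ap_q)) odd apₚ
    where
    fixed : ∀ {r} → Antiperiodic f ν (m * r) x → iter (iter f (2 * m)) r x ≡ x
    fixed {r} ap = begin
      iter (iter f (2 * m)) r x ≡⟨ iter-* f r (2 * m) x ⟨
      iter f (r * (2 * m)) x    ≡⟨ cong (λ t → iter f t x) (rearrange r m) ⟩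
      iter f (2 * (m * r)) x    ≡⟨ antiperiodic⇒periodic (m * r) ap ⟩
      x                         ∎
      where
      rearrange : ∀ r m → r * (2 * m) ≡ 2 * (m * r)
      rearrange = solve-∀

  -- The gcd d of t and 2n is again a period of x; if d divides n then x = ν x, and if d
  -- divides 2n/p then x is antiperiodic of antiperiod n/p.
  antiperiodic-free : ∀ {n x} → Antiperiodic f ν n x → ν x ≢ x →
                      (∀ p m → Prime p → IsOdd p → n ≡ m * p → ¬ Antiperiodic f ν m x) →
                      NoShorterPeriod f (2 * n) x
  antiperiodic-free {n} {x} ap νx≢x not-smaller t t>0 t<2n fᵗx≡x with Bézout.lemma t (2 * n)
  ... | Bézout.result d gcd identity =
    [ divides-n , divides-2n/p ]′ (divisor-of-double (GCD.gcd∣n gcd) d<2n)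
    where
    d<2n : d < 2 * n
    d<2n = ℕₚ.≤-<-trans (∣⇒≤ ⦃ >-nonZero t>0 ⦄ (GCD.gcd∣m gcd)) t<2n

    fᵈx≡x : iter f d x ≡ x
    fᵈx≡x = iter-Bézout f identity fᵗx≡x (antiperiodic⇒periodic n ap)

    divides-n : d ∣ℕ n → ⊥
    divides-n (divides k n≡kd) = νx≢x (begin
      ν x              ≡⟨ ap ⟨
      iter f n x       ≡⟨ cong (λ s → iter f s x) n≡kd ⟩
      iter f (k * d) x ≡⟨ iter-periodic f fᵈx≡x k ⟩
      x                ∎)

    divides-2n/p : ∃[ p ] ∃[ m ] Prime p × IsOdd p × n ≡ m * p × d ∣ℕ 2 * m → ⊥
    divides-2n/p (p , m , p-prime , p-odd , n≡mp , divides k 2m≡kd) =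
      not-smaller p m p-prime p-odd n≡mp
        (antiperiodic-/-odd m p f²ᵐx≡x p-odd (subst (λ s → Antiperiodic f ν s x) n≡mp ap))
      where
      f²ᵐx≡x : iter f (2 * m) x ≡ x
      f²ᵐx≡x = trans (cong (λ s → iter f s x) 2m≡kd) (iter-periodic f fᵈx≡x k)

-- Counting on Fin N

does⇒ : ∀ {A : Set a} (d : Dec A) → does d ≡ true → A
does⇒ (yes a) _ = a

∧-elimˡ : ∀ {p q} → p ∧ q ≡ true → p ≡ true
∧-elimˡ {true} _ = refl

∧-elimʳ : ∀ {p q} → p ∧ q ≡ true → q ≡ true
∧-elimʳ {true} q≡true = q≡true

all⇒All : ∀ (b : A → Bool) xs → all b xs ≡ true → All (λ x → b x ≡ true) xs
all⇒All b []       _   = []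
all⇒All b (x ∷ xs) all≡true = ∧-elimˡ all≡true ∷ all⇒All b xs (∧-elimʳ {b x} all≡true)

module ℕ∑ = Sum ℕₚ.+-0-commutativeMonoid

𝟙 : Bool → ℕ
𝟙 true  = 1
𝟙 false = 0

count : ∀ {N} → (Fin N → Bool) → ℕ
count P = ℕ∑.sum (𝟙 ∘ P)

module _ {N : ℕ} where

  count-cong : ∀ {P Q : Fin N → Bool} → (∀ i → P i ≡ Q i) → count P ≡ count Q
  count-cong P≗Q = ℕ∑.sum-cong-≗ (cong 𝟙 ∘ P≗Q)

  count-false : ∀ {P : Fin N → Bool} → (∀ i → P i ≡ false) → count P ≡ 0
  count-false P≗false = trans (count-cong P≗false) (ℕ∑.sum-replicate-zero N)


  count-∧-not : ∀ (P Q : Fin N → Bool) →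
                count P ≡ count (λ i → P i ∧ not (Q i)) + count (λ i → P i ∧ Q i)
  count-∧-not P Q = trans (ℕ∑.sum-cong-≗ (λ i → split (P i) (Q i)))
                          (ℕ∑.∑-distrib-+ (𝟙 ∘ λ i → P i ∧ not (Q i)) (𝟙 ∘ λ i → P i ∧ Q i))
    where
    split : ∀ p q → 𝟙 p ≡ 𝟙 (p ∧ not q) + 𝟙 (p ∧ q)
    split true  true  = refl
    split true  false = refl
    split false _     = refl

count-true : ∀ N → count {N} (λ _ → true) ≡ N
count-true zero    = refl
count-true (suc N) = cong suc (count-true N)

count-≟ : ∀ {N} (j : Fin N) → count (λ i → does (i ≟ j)) ≡ 1
count-≟ {suc N} zero    = cong suc (count-false {N} (λ _ → refl))
count-≟ {suc N} (suc j) = count-≟ j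

count-∧-≟ : ∀ {N} (P : Fin N → Bool) (j : Fin N) → count (λ i → P i ∧ does (i ≟ j)) ≡ 𝟙 (P j)
count-∧-≟ P j = trans (count-cong at-j) (by-value (P j))
  where
  at-j : ∀ i → P i ∧ does (i ≟ j) ≡ P j ∧ does (i ≟ j)
  at-j i with i ≟ j
  ... | yes refl = refl
  ... | no  _    = trans (∧-zeroʳ (P i)) (sym (∧-zeroʳ (P j)))

  by-value : ∀ b → count (λ i → b ∧ does (i ≟ j)) ≡ 𝟙 b
  by-value true  = count-≟ j
  by-value false = count-false {P = λ i → false ∧ does (i ≟ j)} (λ _ → refl)

image? : ∀ {M N} (f : Fin M → Fin N) (j : Fin N) → Dec (∃[ t ] f t ≡ j)
image? f j = any? (λ t → f t ≟ j)

count-image : ∀ {M N} (f : Fin M → Fin N) → Injective _≡_ _≡_ f →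
              count (λ j → does (image? f j)) ≡ M
count-image {M} {N} f f-inj = begin
  count (λ j → does (image? f j))          ≡⟨ ℕ∑.sum-cong-≗ fibre-size ⟩
  ∑[ j < N ] count (λ t → does (f t ≟ j))  ≡⟨ ℕ∑.∑-comm (λ j t → 𝟙 (does (f t ≟ j))) ⟩
  ∑[ t < M ] count (λ j → does (f t ≟ j))  ≡⟨ ℕ∑.sum-cong-≗ (λ t → trans (count-cong (swap (f t))) (count-≟ (f t))) ⟩
  count {M} (λ _ → true)                   ≡⟨ count-true M ⟩
  M                                        ∎
  where
  open ℕ∑ using (sum-syntax)
  swap : ∀ (i j : Fin N) → does (i ≟ j) ≡ does (j ≟ i)
  swap i j = does-⇔ (mk⇔ sym sym) (i ≟ j) (j ≟ i)

  fibre-size : ∀ j → 𝟙 (does (image? f j)) ≡ count (λ t → does (f t ≟ j))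
  fibre-size j with image? f j
  ... | yes (t₀ , refl) = sym (trans (count-cong (λ t → does-⇔ (mk⇔ f-inj (cong f)) (f t ≟ f t₀) (t ≟ t₀)))
                                     (count-≟ t₀))
  ... | no  ∉image      = sym (count-false (λ t → dec-false (f t ≟ j) (λ ftj → ∉image (t , ftj))))

-- Orbits of a periodic permutation

module Orbit {N : ℕ} (σ : Fin N → Fin N) (M : ℕ) .⦃ _ : NonZero M ⦄
             (σᴹ≡id : ∀ i → iter σ M i ≡ i) (x : Fin N) where

  orbit : Fin M → Fin N
  orbit t = iter σ (toℕ t) x

  in-orbit : Fin N → Bool
  in-orbit j = does (image? orbit j)

  Reachable : Fin N → Set
  Reachable j = ∃[ t ] iter σ t x ≡ j

  in-orbit⇔reachable : ∀ j → (∃[ t ] orbit t ≡ j) ⇔ Reachable j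
  in-orbit⇔reachable j = mk⇔ (λ (t , e) → toℕ t , e) reduce
    where
    reduce : Reachable j → ∃[ t ] orbit t ≡ j
    reduce (t , e) with t divMod M
    ... | result q r t≡r+qM = r , (begin
      iter σ (toℕ r) x                 ≡⟨ cong (iter σ (toℕ r)) (iter-periodic σ (σᴹ≡id x) q) ⟨
      iter σ (toℕ r) (iter σ (q * M) x) ≡⟨ iter-+ σ (toℕ r) (q * M) x ⟨
      iter σ (toℕ r + q * M) x         ≡⟨ cong (λ s → iter σ s x) t≡r+qM ⟨
      iter σ t x                       ≡⟨ e ⟩
      j                                ∎)

  reachable-σ : ∀ j → Reachable (σ j) ⇔ Reachable j
  reachable-σ j = mk⇔ (λ (t , e) → pred M + t , back t e) (λ (t , e) → suc t , cong σ e)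
    where
    back : ∀ t → iter σ t x ≡ σ j → iter σ (pred M + t) x ≡ j
    back t e = begin
      iter σ (pred M + t) x          ≡⟨ iter-+ σ (pred M) t x ⟩
      iter σ (pred M) (iter σ t x)   ≡⟨ cong (iter σ (pred M)) e ⟩
      iter σ (pred M) (σ j)          ≡⟨ iter-pred-inverse σ M σᴹ≡id j ⟩
      j                              ∎

  in-orbit-σ : ∀ j → in-orbit (σ j) ≡ in-orbit j
  in-orbit-σ j = does-⇔ (mk⇔ (from (orbit⇔ j) ∘ to (reachable-σ j) ∘ to (orbit⇔ (σ j)))
                             (from (orbit⇔ (σ j)) ∘ from (reachable-σ j) ∘ to (orbit⇔ j)))
                        (image? orbit (σ j)) (image? orbit j)
    where
    open Equivalence
    orbit⇔ = in-orbit⇔reachable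

  in-orbit⇒reachable : ∀ j → in-orbit j ≡ true → Reachable j
  in-orbit⇒reachable j = Equivalence.to (in-orbit⇔reachable j) ∘ does⇒ (image? orbit j)

  orbit-no-return : (∀ t → NoShorterPeriod σ M (orbit t)) → ∀ s t → toℕ s < toℕ t → orbit s ≢ orbit t
  orbit-no-return free s t s<t e = free s (toℕ t ∸ toℕ s) (ℕₚ.m<n⇒0<n∸m s<t)
    (ℕₚ.≤-<-trans (ℕₚ.m∸n≤m (toℕ t) (toℕ s)) (toℕ<n t)) (begin
      iter σ (toℕ t ∸ toℕ s) (orbit s)    ≡⟨ iter-+ σ (toℕ t ∸ toℕ s) (toℕ s) x ⟨
      iter σ (toℕ t ∸ toℕ s + toℕ s) x    ≡⟨ cong (λ r → iter σ r x) (ℕₚ.m∸n+n≡m (ℕₚ.<⇒≤ s<t)) ⟩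
      orbit t                             ≡⟨ e ⟨
      orbit s                             ∎)

  orbit-injective : (∀ t → NoShorterPeriod σ M (orbit t)) → Injective _≡_ _≡_ orbit
  orbit-injective free {s} {t} e with ℕₚ.<-cmp (toℕ s) (toℕ t)
  ... | tri< s<t _ _ = ⊥-elim (orbit-no-return free s t s<t e)
  ... | tri≈ _ s≡t _ = toℕ-injective s≡t
  ... | tri> _ _ t<s = ⊥-elim (orbit-no-return free t s t<s (sym e))

-- Removing one orbit, which has exactly M points, leaves an invariant set on which σ is still free.
orbits-divide : ∀ {N} (σ : Fin N → Fin N) (M : ℕ) .⦃ _ : NonZero M ⦄ → (∀ i → iter σ M i ≡ i) →
                ∀ (P : Fin N → Bool) → (∀ i → P (σ i) ≡ P i) →
                (∀ i → P i ≡ true → NoShorterPeriod σ M i) → M ∣ℕ count P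
orbits-divide {N} σ M σᴹ≡id P P-inv P-free = go P P-inv P-free (<-wellFounded (count P))
  where
  go : ∀ P → (∀ i → P (σ i) ≡ P i) → (∀ i → P i ≡ true → NoShorterPeriod σ M i) →
       Acc _<_ (count P) → M ∣ℕ count P
  go P P-inv P-free (acc smaller) with any? (λ i → P i Bool.≟ true)
  ... | no  empty    = subst (M ∣ℕ_) (sym (count-false (λ i → ¬-not (λ Pi → empty (i , Pi))))) (M ∣0)
  ... | yes (x , Px) =
    subst (M ∣ℕ_) (sym count-P) (∣m∣n⇒∣m+n (go P′ P′-inv P′-free (smaller count-P′<count-P)) ∣-refl)
    where
    open Orbit σ M σᴹ≡id x

    P′ : Fin N → Bool
    P′ j = P j ∧ not (in-orbit j)

    orbit⊆P : ∀ j → P j ∧ in-orbit j ≡ in-orbit j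
    orbit⊆P j with in-orbit j in eq
    ... | false = ∧-zeroʳ (P j)
    ... | true  with t , refl ← in-orbit⇒reachable j eq =
      trans (∧-identityʳ _) (trans (iter-invariant P P-inv t x) Px)

    count-P : count P ≡ count P′ + M
    count-P = begin
      count P                                    ≡⟨ count-∧-not P in-orbit ⟩
      count P′ + count (λ j → P j ∧ in-orbit j)  ≡⟨ cong (λ k → count P′ + k) (count-cong orbit⊆P) ⟩
      count P′ + count in-orbit                  ≡⟨ cong (λ k → count P′ + k) (count-image orbit orbit-injective′) ⟩
      count P′ + M                               ∎
      where
      orbit-injective′ : Injective _≡_ _≡_ orbit
      orbit-injective′ = orbit-injective (λ t → P-free (orbit t) (trans (iter-invariant P P-inv (toℕ t) x) Px))

    count-P′<count-P : count P′ < count P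
    count-P′<count-P = subst (count P′ <_) (sym count-P) (ℕₚ.m<m+n (count P′) (ℕ.>-nonZero⁻¹ M))

    P′-inv : ∀ j → P′ (σ j) ≡ P′ j
    P′-inv j = cong₂ (λ p o → p ∧ not o) (P-inv j) (in-orbit-σ j)

    P′-free : ∀ j → P′ j ≡ true → NoShorterPeriod σ M j
    P′-free j = P-free j ∘ ∧-elimˡ

-- Inclusion–exclusion

sumℤ-++ : ∀ xs ys → sumℤ (xs ++ ys) ≡ sumℤ xs ℤ.+ sumℤ ys
sumℤ-++ []       ys = sym (ℤₚ.+-identityˡ (sumℤ ys))
sumℤ-++ (x ∷ xs) ys =
  trans (cong (λ s → x ℤ.+ s) (sumℤ-++ xs ys)) (sym (ℤₚ.+-assoc x (sumℤ xs) (sumℤ ys)))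

sumℤ-*ˡ : ∀ c xs → sumℤ (map (c ℤ.*_) xs) ≡ c ℤ.* sumℤ xs
sumℤ-*ˡ c []       = sym (ℤₚ.*-zeroʳ c)
sumℤ-*ˡ c (x ∷ xs) =
  trans (cong (λ s → c ℤ.* x ℤ.+ s) (sumℤ-*ˡ c xs)) (sym (ℤₚ.*-distribˡ-+ c x (sumℤ xs)))

productℤ : List ℤ → ℤ
productℤ = List.foldr ℤ._*_ 1ℤ

inclusion–exclusion : ∀ (x : A → ℤ) ps →
  sumℤ (map (λ T → sign (length T) ℤ.* productℤ (map x T)) (subsets ps))
    ≡ productℤ (map (λ p → 1ℤ - x p) ps)
inclusion–exclusion x []       = refl
inclusion–exclusion x (p ∷ ps) = begin
  sumℤ (map F (Ts ++ map (p ∷_) Ts))                   ≡⟨ cong sumℤ (map-++ F Ts (map (p ∷_) Ts)) ⟩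
  sumℤ (map F Ts ++ map F (map (p ∷_) Ts))             ≡⟨ sumℤ-++ (map F Ts) _ ⟩
  S ℤ.+ sumℤ (map F (map (p ∷_) Ts))                  ≡⟨ cong (λ ys → S ℤ.+ sumℤ ys) F-cons ⟩
  S ℤ.+ sumℤ (map (- x p ℤ.*_) (map F Ts))             ≡⟨ cong (λ t → S ℤ.+ t) (sumℤ-*ˡ (- x p) (map F Ts)) ⟩
  S ℤ.+ - x p ℤ.* S                                    ≡⟨ factor S (x p) ⟩
  (1ℤ - x p) ℤ.* S                                     ≡⟨ cong ((1ℤ - x p) ℤ.*_) (inclusion–exclusion x ps) ⟩
  (1ℤ - x p) ℤ.* productℤ (map (λ q → 1ℤ - x q) ps)    ∎
  where
  F : List _ → ℤ
  F T = sign (length T) ℤ.* productℤ (map x T)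
  Ts = subsets ps
  S = sumℤ (map F Ts)

  factor : ∀ s y → s ℤ.+ - y ℤ.* s ≡ (1ℤ - y) ℤ.* s
  factor = ℤ-Solver.solve-∀

  F-cons : map F (map (p ∷_) Ts) ≡ map (- x p ℤ.*_) (map F Ts)
  F-cons = trans (sym (map-∘ Ts))
                 (trans (map-cong (λ T → swap (sign (length T)) (x p) (productℤ (map x T))) Ts) (map-∘ Ts))
    where
    swap : ∀ s y P → - s ℤ.* (y ℤ.* P) ≡ - y ℤ.* (s ℤ.* P)
    swap = ℤ-Solver.solve-∀

module ℤ∑ = Sum ℤₚ.+-0-commutativeMonoid

χ : Bool → ℤ
χ b = + 𝟙 b

χ-∧ : ∀ p q → χ (p ∧ q) ≡ χ p ℤ.* χ q
χ-∧ true  q = sym (ℤₚ.*-identityˡ (χ q))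
χ-∧ false q = refl

χ-not : ∀ p → 1ℤ - χ p ≡ χ (not p)
χ-not true  = refl
χ-not false = refl

χ-all : ∀ (b : A → Bool) xs → χ (all b xs) ≡ productℤ (map (χ ∘ b) xs)
χ-all b []       = refl
χ-all b (x ∷ xs) = trans (χ-∧ (b x) (all b xs)) (cong (χ (b x) ℤ.*_) (χ-all b xs))

count-ℤ : ∀ {N} (P : Fin N → Bool) → + count P ≡ ℤ∑.sum (χ ∘ P)
count-ℤ {zero}  P = refl
count-ℤ {suc N} P = cong (λ s → χ (P zero) ℤ.+ s) (count-ℤ (P ∘ suc))

sumℤ-∑-comm : ∀ {N} (G : A → Fin N → ℤ) xs →
              sumℤ (map (ℤ∑.sum ∘ G) xs) ≡ ℤ∑.sum (λ i → sumℤ (map (λ x → G x i) xs))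
sumℤ-∑-comm {N = N} G []       = sym (ℤ∑.sum-replicate-zero N)
sumℤ-∑-comm         G (x ∷ xs) = trans (cong (λ s → ℤ∑.sum (G x) ℤ.+ s) (sumℤ-∑-comm G xs))
                                       (sym (ℤ∑.∑-distrib-+ (G x) (λ i → sumℤ (map (λ y → G y i) xs))))

subsets-unique : ∀ {xs : List A} → Unique xs → All (λ T → Unique T × All (_∈ xs) T) (subsets xs)
subsets-unique {xs = []}     []           = ([] , []) ∷ []
subsets-unique {xs = x ∷ xs} (x∉xs ∷ !xs) =
  Allₚ.++⁺ (All.map (λ (!T , T⊆xs) → !T , All.map there T⊆xs) IH)
           (Allₚ.map⁺ (All.map (λ (!T , T⊆xs) → (All.map (All.lookup x∉xs) T⊆xs ∷ !T) ,
                                                 (here refl ∷ All.map there T⊆xs)) IH))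
  where
  IH = subsets-unique !xs

-- Odd prime divisors and Φ₂

OddPrimeDivisor : ℕ → ℕ → Set
OddPrimeDivisor n p = Prime p × IsOdd p × p ∣ℕ n

module _ (n : ℕ) where

  private
    test : ℕ → Bool
    test p = does (prime? p) ∧ (p % 2 ℕ.≡ᵇ 1) ∧ does (p ∣? n)

  oddPrimeDivisors-sound : All (OddPrimeDivisor n) (oddPrimeDivisors n)
  oddPrimeDivisors-sound = All.tabulate λ {p} p∈ →
    let test-p           = proj₂ (∈ₚ.∈-filter⁻ (T? ∘ test) {xs = upTo (suc n)} p∈)
        (p-prime , rest) = Equivalence.to (T-∧ {does (prime? p)}) test-p
        (p-odd , p∣n)    = Equivalence.to (T-∧ {p % 2 ℕ.≡ᵇ 1}) rest
    in does⇒ (prime? p) (Equivalence.to T-≡ p-prime) , ℕₚ.≡ᵇ⇒≡ (p % 2) 1 p-odd ,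
       does⇒ (p ∣? n) (Equivalence.to T-≡ p∣n)

  oddPrimeDivisors-unique : Unique (oddPrimeDivisors n)
  oddPrimeDivisors-unique = Uniqueₚ.filter⁺ (T? ∘ test) (Uniqueₚ.upTo⁺ (suc n))

  oddPrimeDivisors-complete : .⦃ NonZero n ⦄ → ∀ {p} → OddPrimeDivisor n p → p ∈ oddPrimeDivisors n
  oddPrimeDivisors-complete {p} (p-prime , p-odd , p∣n) =
    ∈ₚ.∈-filter⁺ (T? ∘ test) (∈ₚ.∈-upTo⁺ (s≤s (∣⇒≤ p∣n)))
      (Equivalence.from (T-∧ {does (prime? p)}) (Equivalence.from T-≡ (dec-true (prime? p) p-prime) ,
        Equivalence.from (T-∧ {p % 2 ℕ.≡ᵇ 1}) (ℕₚ.≡⇒≡ᵇ (p % 2) 1 p-odd ,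
                                               Equivalence.from T-≡ (dec-true (p ∣? n) p∣n))))

Φ₂-2-power : ∀ {φ n} → oddPrimeDivisors n ≡ [] → Φ₂ φ n ≡ φ n - + 1
Φ₂-2-power eq rewrite eq = refl

Φ₂-not-2-power : ∀ {φ n q qs} → oddPrimeDivisors n ≡ q ∷ qs →
         Φ₂ φ n ≡ sumℤ (map (λ T → sign (length T) ℤ.* φ (quot n (product T))) (subsets (q ∷ qs)))
Φ₂-not-2-power eq rewrite eq = refl

-- Odd permutations of a finite set

module OddPermutation {N : ℕ} (σ τ : Fin N → Fin N) (o : Fin N)
                      (τ-involutive : ∀ i → τ (τ i) ≡ i) (σ-τ-commute : Commute σ τ)
                      (τ-fixed⇒o : ∀ i → τ i ≡ i → i ≡ o) (τo≡o : τ o ≡ o)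
                      (n : ℕ) .⦃ _ : NonZero n ⦄ (σⁿ≡τ : ∀ i → iter σ n i ≡ τ i) where

  open Antiperiodicity σ τ τ-involutive σ-τ-commute

  instance
    2n≢0 : NonZero (2 * n)
    2n≢0 = ℕₚ.m*n≢0 2 n

  σ-periodic : ∀ i → iter σ (2 * n) i ≡ i
  σ-periodic i = antiperiodic⇒periodic n (σⁿ≡τ i)

  σ-injective : Injective _≡_ _≡_ σ
  σ-injective = periodic⇒injective σ (2 * n) σ-periodic

  σo≡o : σ o ≡ o
  σo≡o = τ-fixed⇒o (σ o) (trans (sym (σ-τ-commute o)) (cong σ τo≡o))

  antiperiodic? : ∀ m i → Dec (Antiperiodic σ τ m i)
  antiperiodic? m i = iter σ m i ≟ τ i

  antiperiodicᵇ : ℕ → Fin N → Bool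
  antiperiodicᵇ m i = does (antiperiodic? m i)

  antiperiodicᵇ-σ : ∀ m i → antiperiodicᵇ m (σ i) ≡ antiperiodicᵇ m i
  antiperiodicᵇ-σ m i = does-⇔ (mk⇔ to from) (antiperiodic? m (σ i)) (antiperiodic? m i)
    where
    σᵐ∘σ : iter σ m (σ i) ≡ σ (iter σ m i)
    σᵐ∘σ = iter-commute σ {σ} (λ _ → refl) m i
    to : Antiperiodic σ τ m (σ i) → Antiperiodic σ τ m i
    to ap = σ-injective (trans (sym σᵐ∘σ) (trans ap (sym (σ-τ-commute i))))
    from : Antiperiodic σ τ m i → Antiperiodic σ τ m (σ i)
    from ap = trans σᵐ∘σ (trans (cong σ ap) (σ-τ-commute i))

  τ-fixed? : ∀ i → Dec (τ i ≡ i)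
  τ-fixed? i = τ i ≟ i

  τ-fixedᵇ-σ : ∀ i → does (τ-fixed? (σ i)) ≡ does (τ-fixed? i)
  τ-fixedᵇ-σ i = does-⇔ (mk⇔ (λ e → σ-injective (trans (σ-τ-commute i) e))
                              (λ e → trans (sym (σ-τ-commute i)) (cong σ e)))
                         (τ (σ i) ≟ σ i) (τ i ≟ i)

  antiperiodicᵇ-o : ∀ m → antiperiodicᵇ m o ≡ true
  antiperiodicᵇ-o m = dec-true (antiperiodic? m o) (trans (iter-fixed σ σo≡o m) (sym τo≡o))

  antiperiodicᵇ-n : ∀ i → antiperiodicᵇ n i ≡ true
  antiperiodicᵇ-n i = dec-true (antiperiodic? n i) (σⁿ≡τ i)

  antiperiodicᵇ-coprime : ∀ m p q i → IsOdd p → IsOdd q → Coprime p q →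
                          antiperiodicᵇ m i ≡ antiperiodicᵇ (m * p) i ∧ antiperiodicᵇ (m * q) i
  antiperiodicᵇ-coprime m p q i p-odd q-odd coprime = does-⇔
    (mk⇔ (λ ap → antiperiodic-*-odd m p p-odd ap , antiperiodic-*-odd m q q-odd ap)
         (λ (apₚ , ap_q) → antiperiodic-coprime m p q p-odd coprime apₚ ap_q))
    (antiperiodic? m i) (antiperiodic? (m * p) i ×-dec antiperiodic? (m * q) i)

  product-cofactor : ∀ {T} → Unique T → All (OddPrimeDivisor n) T → n ≡ quot n (product T) * product T
  product-cofactor !T T-div with product-∣ !T (All.map proj₁ T-div) (All.map (proj₂ ∘ proj₂) T-div)
  ... | divides m n≡mD =
    subst (λ k → n ≡ k * _) (sym (quot-exact m _ ⦃ productOfPrimes≢0 (All.map proj₁ T-div) ⦄ n≡mD)) n≡mD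

  antiperiodicᵇ-quot-product : ∀ {T} → Unique T → All (OddPrimeDivisor n) T → ∀ i →
    antiperiodicᵇ (quot n (product T)) i ≡ all (λ p → antiperiodicᵇ (quot n p) i) T
  antiperiodicᵇ-quot-product [] [] i = trans (cong (λ m → antiperiodicᵇ m i) (n/1≡n n)) (antiperiodicᵇ-n i)
  antiperiodicᵇ-quot-product {p ∷ T} !pT@(p∉T ∷ !T) pT-div@((p-prime , p-odd , _) ∷ T-div) i = begin
    anti m                                ≡⟨ antiperiodicᵇ-coprime m D p i D-odd p-odd (Coprimality.sym p⊥D) ⟩
    anti (m * D) ∧ anti (m * p)           ≡⟨ cong₂ (λ k l → anti k ∧ anti l) quot-p quot-D ⟨
    anti (quot n p) ∧ anti (quot n D)     ≡⟨ cong (anti (quot n p) ∧_) (antiperiodicᵇ-quot-product !T T-div i) ⟩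
    anti (quot n p) ∧ all (λ q → anti (quot n q)) T ∎
    where
    anti : ℕ → Bool
    anti k = antiperiodicᵇ k i

    D = product T
    m = quot n (p * D)

    n≡m[pD] : n ≡ m * (p * D)
    n≡m[pD] = product-cofactor !pT pT-div

    D-odd : IsOdd D
    D-odd = odd-product (All.map (proj₁ ∘ proj₂) T-div)

    p⊥D : Coprime p D
    p⊥D = prime∉⇒coprime-product p-prime (All.map proj₁ T-div) (Allₚ.All¬⇒¬Any p∉T)

    quot-p : quot n p ≡ m * D
    quot-p = quot-exact (m * D) p ⦃ prime⇒nonZero p-prime ⦄ (trans n≡m[pD] (rearrange m p D))
      where
      rearrange : ∀ m p D → m * (p * D) ≡ m * D * p
      rearrange = solve-∀

    quot-D : quot n D ≡ m * p
    quot-D = quot-exact (m * p) D ⦃ productOfPrimes≢0 (All.map proj₁ T-div) ⦄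
                        (trans n≡m[pD] (sym (ℕₚ.*-assoc m p D)))

  Primitive : Fin N → Bool
  Primitive i = all (λ p → not (antiperiodicᵇ (quot n p) i)) (oddPrimeDivisors n)

  Free : Fin N → Bool
  Free i = Primitive i ∧ not (does (τ-fixed? i))

  Free-σ : ∀ i → Free (σ i) ≡ Free i
  Free-σ i = cong₂ (λ p f → p ∧ not f)
               (cong and (map-cong (λ p → cong not (antiperiodicᵇ-σ (quot n p) i)) (oddPrimeDivisors n)))
               (τ-fixedᵇ-σ i)

  Free-free : ∀ i → Free i ≡ true → NoShorterPeriod σ (2 * n) i
  Free-free i Free-i = antiperiodic-free (σⁿ≡τ i) τi≢i not-smaller
    where
    τi≢i : τ i ≢ i
    τi≢i τi≡i =
      contradiction (trans (sym (cong not (dec-true (τ-fixed? i) τi≡i))) (∧-elimʳ {Primitive i} Free-i)) λ ()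

    not-smaller : ∀ p m → Prime p → IsOdd p → n ≡ m * p → ¬ Antiperiodic σ τ m i
    not-smaller p m p-prime p-odd n≡mp ap = contradiction (begin
      not true                           ≡⟨ cong not (dec-true (antiperiodic? m i) ap) ⟨
      not (antiperiodicᵇ m i)            ≡⟨ cong (λ k → not (antiperiodicᵇ k i)) quot-p ⟨
      not (antiperiodicᵇ (quot n p) i)   ≡⟨ All.lookup primitive-i p∈ ⟩
      true                               ∎) λ ()
      where
      primitive-i = all⇒All _ (oddPrimeDivisors n) (∧-elimˡ Free-i)
      p∈ = oddPrimeDivisors-complete n (p-prime , p-odd , divides m n≡mp)
      quot-p = quot-exact m p ⦃ prime⇒nonZero p-prime ⦄ n≡mp

  2n∣count-Free : 2 * n ∣ℕ count Free
  2n∣count-Free = orbits-divide σ (2 * n) σ-periodic Free Free-σ Free-free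

  count-Primitive : count Primitive ≡ 𝟙 (Primitive o) + count Free
  count-Primitive = begin
    count Primitive                                           ≡⟨ count-∧-not Primitive (does ∘ τ-fixed?) ⟩
    count Free + count (λ i → Primitive i ∧ does (τ-fixed? i)) ≡⟨ cong (λ k → count Free + k) (count-cong fixed⇔o) ⟩
    count Free + count (λ i → Primitive i ∧ does (i ≟ o))      ≡⟨ cong (λ k → count Free + k) (count-∧-≟ Primitive o) ⟩
    count Free + 𝟙 (Primitive o)                              ≡⟨ ℕₚ.+-comm (count Free) _ ⟩
    𝟙 (Primitive o) + count Free                              ∎
    where
    fixed⇔o : ∀ i → Primitive i ∧ does (τ-fixed? i) ≡ Primitive i ∧ does (i ≟ o)
    fixed⇔o i = cong (Primitive i ∧_) (does-⇔ (mk⇔ (τ-fixed⇒o i) (λ { refl → τo≡o })) (τ-fixed? i) (i ≟ o))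

  subsets-divide : All (λ T → Unique T × All (OddPrimeDivisor n) T) (subsets (oddPrimeDivisors n))
  subsets-divide = All.map (λ (!T , T⊆ps) → !T , All.map (All.lookup (oddPrimeDivisors-sound n)) T⊆ps)
                           (subsets-unique (oddPrimeDivisors-unique n))

  inclusion–exclusion-at : ∀ i →
    sumℤ (map (λ T → sign (length T) ℤ.* χ (antiperiodicᵇ (quot n (product T)) i)) (subsets (oddPrimeDivisors n)))
      ≡ χ (Primitive i)
  inclusion–exclusion-at i = begin
    sumℤ (map (λ T → sign (length T) ℤ.* χ (antiperiodicᵇ (quot n (product T)) i)) (subsets ps))
      ≡⟨ cong sumℤ (map-cong-local (All.map (λ {T} (!T , T-div) → cong (sign (length T) ℤ.*_)
           (trans (cong χ (antiperiodicᵇ-quot-product !T T-div i)) (χ-all b T))) subsets-divide)) ⟩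
    sumℤ (map (λ T → sign (length T) ℤ.* productℤ (map (χ ∘ b) T)) (subsets ps))
      ≡⟨ inclusion–exclusion (χ ∘ b) ps ⟩
    productℤ (map (λ p → 1ℤ - χ (b p)) ps)
      ≡⟨ cong productℤ (map-cong (χ-not ∘ b) ps) ⟩
    productℤ (map (χ ∘ not ∘ b) ps)
      ≡⟨ χ-all (not ∘ b) ps ⟨
    χ (Primitive i)
      ∎
    where
    ps = oddPrimeDivisors n
    b : ℕ → Bool
    b p = antiperiodicᵇ (quot n p) i

  module _ (φ : ℕ → ℕ) (φ≡count : ∀ m d → n ≡ m * d → IsOdd d → φ m ≡ count (antiperiodicᵇ m)) where

    signed-sum≡count :
      sumℤ (map (λ T → sign (length T) ℤ.* + φ (quot n (product T))) (subsets (oddPrimeDivisors n)))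
        ≡ + count Primitive
    signed-sum≡count = begin
      sumℤ (map (λ T → sign (length T) ℤ.* + φ (quot n (product T))) Ts)
        ≡⟨ cong sumℤ (map-cong-local (All.map term subsets-divide)) ⟩
      sumℤ (map (ℤ∑.sum ∘ G) Ts)
        ≡⟨ sumℤ-∑-comm G Ts ⟩
      ℤ∑.sum (λ i → sumℤ (map (λ T → G T i) Ts))
        ≡⟨ ℤ∑.sum-cong-≗ inclusion–exclusion-at ⟩
      ℤ∑.sum (χ ∘ Primitive)
        ≡⟨ count-ℤ Primitive ⟨
      + count Primitive
        ∎
      where
      Ts = subsets (oddPrimeDivisors n)

      G : List ℕ → Fin N → ℤ
      G T i = sign (length T) ℤ.* χ (antiperiodicᵇ (quot n (product T)) i)

      term : ∀ {T} → Unique T × All (OddPrimeDivisor n) T →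
             sign (length T) ℤ.* + φ (quot n (product T)) ≡ ℤ∑.sum (G T)
      term {T} (!T , T-div) = begin
        s ℤ.* + φ m                          ≡⟨ cong (λ k → s ℤ.* + k) φm≡ ⟩
        s ℤ.* + count (antiperiodicᵇ m)      ≡⟨ cong (s ℤ.*_) (count-ℤ (antiperiodicᵇ m)) ⟩
        s ℤ.* ℤ∑.sum (χ ∘ antiperiodicᵇ m)   ≡⟨ *-distribˡ-sum s (χ ∘ antiperiodicᵇ m) ⟩
        ℤ∑.sum (G T)                         ∎
        where
        s = sign (length T)
        m = quot n (product T)
        φm≡ : φ m ≡ count (antiperiodicᵇ m)
        φm≡ = φ≡count m (product T) (product-cofactor !T T-div) (odd-product (All.map (proj₁ ∘ proj₂) T-div))

    Φ₂-count-2-power : oddPrimeDivisors n ≡ [] → Φ₂ (λ m → + φ m) n ≡ + count Free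
    Φ₂-count-2-power eq = begin
      Φ₂ (λ m → + φ m) n                     ≡⟨ Φ₂-2-power {λ m → + φ m} {n} eq ⟩
      + φ n - + 1                            ≡⟨ cong (λ k → + k - + 1) φn≡ ⟩
      + count Primitive - + 1                ≡⟨ cong (λ k → + k - + 1) count-Primitive ⟩
      + (𝟙 (Primitive o) + count Free) - + 1 ≡⟨ cong (λ b → + (𝟙 b + count Free) - + 1) (all-primitive o) ⟩
      + count Free                           ∎
      where
      all-primitive : ∀ i → Primitive i ≡ true
      all-primitive i = cong (all (λ p → not (antiperiodicᵇ (quot n p) i))) eq

      φn≡ : φ n ≡ count Primitive
      φn≡ = trans (φ≡count n 1 (sym (ℕₚ.*-identityʳ n)) refl)
                  (count-cong (λ i → trans (antiperiodicᵇ-n i) (sym (all-primitive i))))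

    Φ₂-count-not-2-power : ∀ {q qs} → oddPrimeDivisors n ≡ q ∷ qs → Φ₂ (λ m → + φ m) n ≡ + count Free
    Φ₂-count-not-2-power {q} {qs} eq = begin
      Φ₂ (λ m → + φ m) n                          ≡⟨ Φ₂-not-2-power {λ m → + φ m} {n} eq ⟩
      sumℤ (map F (subsets (q ∷ qs)))             ≡⟨ cong (λ ps → sumℤ (map F (subsets ps))) eq ⟨
      sumℤ (map F (subsets (oddPrimeDivisors n))) ≡⟨ signed-sum≡count ⟩
      + count Primitive                           ≡⟨ cong +_ count-Primitive ⟩
      + (𝟙 (Primitive o) + count Free)            ≡⟨ cong (λ b → + (𝟙 b + count Free)) o-not-primitive ⟩
      + count Free                                ∎
      where
      F : List ℕ → ℤ
      F T = sign (length T) ℤ.* + φ (quot n (product T))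

      o-not-primitive : Primitive o ≡ false
      o-not-primitive = trans (cong (all (λ p → not (antiperiodicᵇ (quot n p) o))) eq)
                              (cong (λ b → not b ∧ all (λ p → not (antiperiodicᵇ (quot n p) o)) qs)
                                    (antiperiodicᵇ-o (quot n q)))

    Φ₂-count : Φ₂ (λ m → + φ m) n ≡ + count Free
    -- Not a `with`: abstracting over oddPrimeDivisors n would also rewrite it inside count Free.
    Φ₂-count = by-cases (oddPrimeDivisors n) refl
      where
      by-cases : ∀ ps → oddPrimeDivisors n ≡ ps → Φ₂ (λ m → + φ m) n ≡ + count Free
      by-cases []      = Φ₂-count-2-power
      by-cases (_ ∷ _) = Φ₂-count-not-2-power

    Φ₂-divisible : + (2 * n) ∣ Φ₂ (λ m → + φ m) n
    Φ₂-divisible = subst (+ (2 * n) ∣_) (sym Φ₂-count) 2n∣count-Free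


-- Odd maps with finitely many antiperiodic points

record Enumeration {A : Set a} (P : A → Set a) : Set a where
  field
    elements : List A
    unique   : Unique elements
    complete : ∀ x → x ∈ elements ⇔ P x

enumeration-⇔ : ∀ {A : Set a} {P Q : A → Set a} → (∀ x → P x ⇔ Q x) → Enumeration P → Enumeration Q
enumeration-⇔ P⇔Q E = record
  { elements = elements
  ; unique   = unique
  ; complete = λ x → mk⇔ (Equivalence.to (P⇔Q x) ∘ Equivalence.to (complete x))
                         (Equivalence.from (complete x) ∘ Equivalence.from (P⇔Q x))
  }
  where open Enumeration E

record SymmetricSet a : Set (lsuc a) where
  field
    Carrier        : Set a
    neg            : Carrier → Carrier
    0#             : Carrier
    neg-involutive : ∀ x → neg (neg x) ≡ x
    neg-0#         : neg 0# ≡ 0#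
    neg-fixed⇒0#   : ∀ x → neg x ≡ x → x ≡ 0#

unique⇒lookup-injective : ∀ {xs : List A} → Unique xs → Injective _≡_ _≡_ (lookup xs)
unique⇒lookup-injective {xs = x ∷ xs} (x∉xs ∷ !xs) {zero}  {zero}  _ = refl
unique⇒lookup-injective {xs = x ∷ xs} (x∉xs ∷ !xs) {zero}  {suc j} e =
  contradiction (subst (_∈ xs) (sym e) (∈ₚ.∈-lookup j)) (Allₚ.All¬⇒¬Any x∉xs)
unique⇒lookup-injective {xs = x ∷ xs} (x∉xs ∷ !xs) {suc i} {zero}  e =
  contradiction (subst (_∈ xs) e (∈ₚ.∈-lookup i)) (Allₚ.All¬⇒¬Any x∉xs)
unique⇒lookup-injective {xs = x ∷ xs} (x∉xs ∷ !xs) {suc i} {suc j} e =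
  cong suc (unique⇒lookup-injective !xs e)

-- Indexing the antiperiodic points of antiperiod n by Fin N turns h and neg into permutations of Fin N.
module RestrictToSolutions (𝕊 : SymmetricSet a) (h : SymmetricSet.Carrier 𝕊 → SymmetricSet.Carrier 𝕊)
                           (h-odd : Commute h (SymmetricSet.neg 𝕊)) (n : ℕ) .⦃ _ : NonZero n ⦄
                           (E : Enumeration (Antiperiodic h (SymmetricSet.neg 𝕊) n)) where

  open SymmetricSet 𝕊
  open Enumeration E
  open Antiperiodicity h neg neg-involutive h-odd

  N : ℕ
  N = length elements

  point : Fin N → Carrier
  point = lookup elements

  point-injective : Injective _≡_ _≡_ point
  point-injective = unique⇒lookup-injective unique

  point-antiperiodic : ∀ i → Antiperiodic h neg n (point i)
  point-antiperiodic i = Equivalence.to (complete (point i)) (∈ₚ.∈-lookup i)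

  index : ∀ {x} → Antiperiodic h neg n x → Fin N
  index {x} ap = Any.index (Equivalence.from (complete x) ap)

  point-index : ∀ {x} (ap : Antiperiodic h neg n x) → point (index ap) ≡ x
  point-index {x} ap = sym (lookup-index (Equivalence.from (complete x) ap))

  h0≡0 : h 0# ≡ 0#
  h0≡0 = neg-fixed⇒0# (h 0#) (trans (sym (h-odd 0#)) (cong h neg-0#))

  σ τ : Fin N → Fin N
  σ i = index {h (point i)} (trans (iter-commute h {h} (λ _ → refl) n (point i))
                                   (trans (cong h (point-antiperiodic i)) (h-odd (point i))))
  τ i = index {neg (point i)} (trans (iter-commute h h-odd n (point i)) (cong neg (point-antiperiodic i)))

  o : Fin N
  o = index {0#} (trans (iter-fixed h h0≡0 n) (sym neg-0#))

  point-σ : ∀ i → point (σ i) ≡ h (point i)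
  point-σ i = point-index _

  point-τ : ∀ i → point (τ i) ≡ neg (point i)
  point-τ i = point-index _

  point-o : point o ≡ 0#
  point-o = point-index _

  point-iter : ∀ m i → point (iter σ m i) ≡ iter h m (point i)
  point-iter zero    i = refl
  point-iter (suc m) i = trans (point-σ (iter σ m i)) (cong h (point-iter m i))

  τ-involutive : ∀ i → τ (τ i) ≡ i
  τ-involutive i =
    point-injective (trans (point-τ (τ i)) (trans (cong neg (point-τ i)) (neg-involutive (point i))))

  σ-τ-commute : Commute σ τ
  σ-τ-commute i = point-injective (begin
    point (σ (τ i))   ≡⟨ point-σ (τ i) ⟩
    h (point (τ i))   ≡⟨ cong h (point-τ i) ⟩
    h (neg (point i)) ≡⟨ h-odd (point i) ⟩
    neg (h (point i)) ≡⟨ cong neg (point-σ i) ⟨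
    neg (point (σ i)) ≡⟨ point-τ (σ i) ⟨
    point (τ (σ i))   ∎)

  τ-fixed⇒o : ∀ i → τ i ≡ i → i ≡ o
  τ-fixed⇒o i τi≡i = point-injective
    (trans (neg-fixed⇒0# (point i) (trans (sym (point-τ i)) (cong point τi≡i))) (sym point-o))

  τo≡o : τ o ≡ o
  τo≡o = point-injective (trans (point-τ o) (trans (cong neg point-o) (trans neg-0# (sym point-o))))

  antiperiodic⇔ : ∀ m i → Antiperiodic σ τ m i ⇔ Antiperiodic h neg m (point i)
  antiperiodic⇔ m i = mk⇔
    (λ ap → trans (sym (point-iter m i)) (trans (cong point ap) (point-τ i)))
    (λ ap → point-injective (trans (point-iter m i) (trans ap (sym (point-τ i)))))

  σⁿ≡τ : ∀ i → iter σ n i ≡ τ i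
  σⁿ≡τ i = Equivalence.from (antiperiodic⇔ n i) (point-antiperiodic i)

  open OddPermutation σ τ o τ-involutive σ-τ-commute τ-fixed⇒o τo≡o n σⁿ≡τ public

  -- Antiperiodic points of antiperiod m are antiperiodic of antiperiod n = m d, d odd,
  -- so they are counted among the points of Fin N.
  count-antiperiodic : ∀ m d → n ≡ m * d → IsOdd d → (E′ : Enumeration (Antiperiodic h neg m)) →
                       count (antiperiodicᵇ m) ≡ length (Enumeration.elements E′)
  count-antiperiodic m d n≡md d-odd E′ = begin
    count (antiperiodicᵇ m)            ≡⟨ count-cong (λ j → does-⇔ (image⇔ j) (antiperiodic? m j) (image? f j)) ⟩
    count (λ j → does (image? f j))    ≡⟨ count-image f f-injective ⟩
    length (Enumeration.elements E′)   ∎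
    where
    module E′ = Enumeration E′
    f : Fin (length E′.elements) → Fin N
    f k = index (subst (λ s → Antiperiodic h neg s _) (sym n≡md)
                       (antiperiodic-*-odd m d d-odd (Equivalence.to (E′.complete _) (∈ₚ.∈-lookup k))))

    point-f : ∀ k → point (f k) ≡ lookup E′.elements k
    point-f k = point-index _

    f-injective : Injective _≡_ _≡_ f
    f-injective {k} {l} e = unique⇒lookup-injective E′.unique
      (trans (sym (point-f k)) (trans (cong point e) (point-f l)))

    image⇔ : ∀ j → Antiperiodic σ τ m j ⇔ (∃[ k ] f k ≡ j)
    image⇔ j = mk⇔
      (λ ap → let k∈ = Equivalence.from (E′.complete (point j)) (Equivalence.to (antiperiodic⇔ m j) ap)
              in Any.index k∈ , point-injective (trans (point-f _) (sym (lookup-index k∈))))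
      (λ { (k , refl) → Equivalence.from (antiperiodic⇔ m (f k)) (subst (Antiperiodic h neg m) (sym (point-f k))
                                                                     (Equivalence.to (E′.complete _) (∈ₚ.∈-lookup k))) })

module _ (𝕊 : SymmetricSet a) where

  open SymmetricSet 𝕊

  Φ₂-odd-map-divisible : ∀ (h : Carrier → Carrier) → Commute h neg →
                         (E : ∀ m → 1 ≤ m → Enumeration (Antiperiodic h neg m)) →
                         (φ : ℕ → ℕ) → (∀ m (1≤m : 1 ≤ m) → φ m ≡ length (Enumeration.elements (E m 1≤m))) →
                         ∀ n → 1 ≤ n → + (2 * n) ∣ Φ₂ (λ m → + φ m) n
  Φ₂-odd-map-divisible h h-odd E φ φ≡length n@(suc _) _ = Φ₂-divisible φ φ≡count
    where
    open RestrictToSolutions 𝕊 h h-odd n (E n (s≤s z≤n))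
    φ≡count : ∀ m d → n ≡ m * d → IsOdd d → φ m ≡ count (antiperiodicᵇ m)
    φ≡count m@(suc _) d n≡md d-odd =
      trans (φ≡length m (s≤s z≤n)) (sym (count-antiperiodic m d n≡md d-odd (E m (s≤s z≤n))))

-- Symmetric subsets, iterates and products

symmetricSet : ∀ {a b} → SymmetricSubset a b → SymmetricSet b
symmetricSet {a} Σ𝕊 = record
  { Carrier        = S
  ; neg            = negS
  ; 0#             = 0S
  ; neg-involutive = λ x → ι-inj (trans (ι-neg (negS x)) (trans (cong -V_ (ι-neg x)) (⁻¹-involutive (ι x))))
  ; neg-0#         = ι-inj (trans (ι-neg 0S) (trans (cong -V_ ι-0) (trans ε⁻¹≈ε (sym ι-0))))
  ; neg-fixed⇒0#   = λ x negx≡x → ι-inj (trans (2-torsion-free (ι x) (begin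
      ι x +V ι x        ≡⟨ cong (ι x +V_) (cong ι negx≡x) ⟨
      ι x +V ι (negS x) ≡⟨ cong (ι x +V_) (ι-neg x) ⟩
      ι x +V (-V ι x)   ≡⟨ IsAbelianGroup.inverseʳ isAbGrp (ι x) ⟩
      0V                ∎)) (sym ι-0))
  }
  where
  open SymmetricSubset Σ𝕊

  group : Group a a
  group = record { isGroup = IsAbelianGroup.isGroup isAbGrp }

  open GroupProperties group

solutions⇒enumeration : ∀ {a b} (Σ𝕊 : SymmetricSubset a b) {h n} →
                        Solutions Σ𝕊 h n → Enumeration (Antiperiodic h (SymmetricSubset.negS Σ𝕊) n)
solutions⇒enumeration Σ𝕊 sols = record { elements = sols′ ; unique = unique ; complete = complete }
  where open Solutions sols renaming (sols to sols′)

antiperiodic-iter : ∀ (f ν : A → A) k m x → Antiperiodic f ν (k * m) x ⇔ Antiperiodic (iter f k) ν m x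
antiperiodic-iter f ν k m x = mk⇔ (trans (sym fᵏᵐ≡)) (trans fᵏᵐ≡)
  where
  fᵏᵐ≡ : iter f (k * m) x ≡ iter (iter f k) m x
  fᵏᵐ≡ = trans (cong (λ t → iter f t x) (ℕₚ.*-comm k m)) (iter-* f m k x)

Vec-symmetricSet : SymmetricSet a → ℕ → SymmetricSet a
Vec-symmetricSet 𝕊 j = record
  { Carrier        = Vec Carrier j
  ; neg            = Vec.map neg
  ; 0#             = Vec.replicate j 0#
  ; neg-involutive = involutive
  ; neg-0#         = trans (Vecₚ.map-replicate neg 0# j) (cong (Vec.replicate j) neg-0#)
  ; neg-fixed⇒0#   = fixed⇒0#
  }
  where
  open SymmetricSet 𝕊

  involutive : ∀ {j} (v : Vec Carrier j) → Vec.map neg (Vec.map neg v) ≡ v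
  involutive Vec.[]       = refl
  involutive (x Vec.∷ v) = cong₂ Vec._∷_ (neg-involutive x) (involutive v)

  fixed⇒0# : ∀ {j} (v : Vec Carrier j) → Vec.map neg v ≡ v → v ≡ Vec.replicate j 0#
  fixed⇒0# Vec.[]       _ = refl
  fixed⇒0# (x Vec.∷ v) e =
    cong₂ Vec._∷_ (neg-fixed⇒0# x (Vecₚ.∷-injectiveˡ e)) (fixed⇒0# v (Vecₚ.∷-injectiveʳ e))

≗-lookup⇒≡ : ∀ {j} {u v : Vec A j} → (∀ i → Vec.lookup u i ≡ Vec.lookup v i) → u ≡ v
≗-lookup⇒≡ {u = u} {v} e =
  trans (sym (Vecₚ.tabulate∘lookup u)) (trans (Vecₚ.tabulate-cong e) (Vecₚ.tabulate∘lookup v))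

pointwise : ∀ {j} → (Fin j → A → A) → Vec A j → Vec A j
pointwise fs v = Vec.tabulate (λ i → fs i (Vec.lookup v i))

lookup-pointwise : ∀ {j} (fs : Fin j → A → A) v i → Vec.lookup (pointwise fs v) i ≡ fs i (Vec.lookup v i)
lookup-pointwise fs v = Vecₚ.lookup∘tabulate (λ i → fs i (Vec.lookup v i))

lookup-iter-pointwise : ∀ {j} (fs : Fin j → A → A) m v i →
                        Vec.lookup (iter (pointwise fs) m v) i ≡ iter (fs i) m (Vec.lookup v i)
lookup-iter-pointwise fs zero    v i = refl
lookup-iter-pointwise fs (suc m) v i =
  trans (lookup-pointwise fs (iter (pointwise fs) m v) i) (cong (fs i) (lookup-iter-pointwise fs m v i))

module _ {j} (fs : Fin j → A → A) (ν : A → A) where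

  pointwise-commute : (∀ i → Commute (fs i) ν) → Commute (pointwise fs) (Vec.map ν)
  pointwise-commute commute v = ≗-lookup⇒≡ λ i → begin
    Vec.lookup (pointwise fs (Vec.map ν v)) i  ≡⟨ lookup-pointwise fs (Vec.map ν v) i ⟩
    fs i (Vec.lookup (Vec.map ν v) i)          ≡⟨ cong (fs i) (Vecₚ.lookup-map i ν v) ⟩
    fs i (ν (Vec.lookup v i))                  ≡⟨ commute i (Vec.lookup v i) ⟩
    ν (fs i (Vec.lookup v i))                  ≡⟨ cong ν (lookup-pointwise fs v i) ⟨
    ν (Vec.lookup (pointwise fs v) i)          ≡⟨ Vecₚ.lookup-map i ν (pointwise fs v) ⟨
    Vec.lookup (Vec.map ν (pointwise fs v)) i  ∎

  antiperiodic-pointwise : ∀ m v → (∀ i → Antiperiodic (fs i) ν m (Vec.lookup v i)) ⇔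
                                   Antiperiodic (pointwise fs) (Vec.map ν) m v
  antiperiodic-pointwise m v = mk⇔
    (λ aps → ≗-lookup⇒≡ λ i →
       trans (lookup-iter-pointwise fs m v i) (trans (aps i) (sym (Vecₚ.lookup-map i ν v))))
    (λ ap i →
       trans (sym (lookup-iter-pointwise fs m v i)) (trans (cong (λ w → Vec.lookup w i) ap) (Vecₚ.lookup-map i ν v)))

length-cartesianProductWith : ∀ {b c} {B : Set b} {C : Set c} (f : A → B → C) xs ys →
                              length (cartesianProductWith f xs ys) ≡ length xs * length ys
length-cartesianProductWith f []       ys = refl
length-cartesianProductWith f (x ∷ xs) ys = trans (length-++ (map (f x) ys))
  (cong₂ _+_ (length-map (f x) ys) (length-cartesianProductWith f xs ys))

vecProduct : ∀ {j} → (Fin j → List A) → List (Vec A j)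
vecProduct {j = zero}  Ls = Vec.[] ∷ []
vecProduct {j = suc j} Ls = cartesianProductWith Vec._∷_ (Ls zero) (vecProduct (Ls ∘ suc))

length-vecProduct : ∀ {j} (Ls : Fin j → List A) → length (vecProduct Ls) ≡ product (tabulate (length ∘ Ls))
length-vecProduct {j = zero}  Ls = refl
length-vecProduct {j = suc j} Ls = trans (length-cartesianProductWith Vec._∷_ (Ls zero) (vecProduct (Ls ∘ suc)))
                                         (cong (length (Ls zero) *_) (length-vecProduct (Ls ∘ suc)))

vecProduct-unique : ∀ {j} (Ls : Fin j → List A) → (∀ i → Unique (Ls i)) → Unique (vecProduct Ls)
vecProduct-unique {j = zero}  Ls !Ls = [] ∷ []
vecProduct-unique {j = suc j} Ls !Ls =
  Uniqueₚ.cartesianProductWith⁺ Vec._∷_ Vecₚ.∷-injective (!Ls zero) (vecProduct-unique (Ls ∘ suc) (!Ls ∘ suc))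

∈-vecProduct : ∀ {j} (Ls : Fin j → List A) v → v ∈ vecProduct Ls ⇔ (∀ i → Vec.lookup v i ∈ Ls i)
∈-vecProduct {j = zero}  Ls Vec.[] = mk⇔ (λ _ ()) (λ _ → here refl)
∈-vecProduct {j = suc j} Ls (x Vec.∷ v) = mk⇔ to from
  where
  to : x Vec.∷ v ∈ vecProduct Ls → ∀ i → Vec.lookup (x Vec.∷ v) i ∈ Ls i
  to mem with ∈ₚ.∈-cartesianProductWith⁻ Vec._∷_ (Ls zero) (vecProduct (Ls ∘ suc)) mem
  ... | _ , _ , x∈ , v∈ , refl = λ where
    zero    → x∈
    (suc i) → Equivalence.to (∈-vecProduct (Ls ∘ suc) v) v∈ i
  from : (∀ i → Vec.lookup (x Vec.∷ v) i ∈ Ls i) → x Vec.∷ v ∈ vecProduct Ls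
  from mem = ∈ₚ.∈-cartesianProductWith⁺ Vec._∷_ (mem zero)
                                        (Equivalence.from (∈-vecProduct (Ls ∘ suc) v) (mem ∘ suc))

enumeration-Π : ∀ {j} {P : Fin j → A → Set a} → (∀ i → Enumeration (P i)) →
                Enumeration (λ v → ∀ i → P i (Vec.lookup v i))
enumeration-Π {P = P} E = record
  { elements = vecProduct (Enumeration.elements ∘ E)
  ; unique   = vecProduct-unique (Enumeration.elements ∘ E) (Enumeration.unique ∘ E)
  ; complete = λ v → mk⇔
      (λ mem i → Equivalence.to (Enumeration.complete (E i) _) (Equivalence.to (∈-vecProduct _ v) mem i))
      (λ Pv → Equivalence.from (∈-vecProduct _ v) (λ i → Equivalence.from (Enumeration.complete (E i) _) (Pv i)))
  }

module _ {a b} (Σ𝕊 : SymmetricSubset a b) where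

  open SymmetricSubset Σ𝕊 using (S; negS)

  Φ₂-iterate-divisible : ∀ (g : S → S) → Odd Σ𝕊 g → (fin : FinitelyManySolutions Σ𝕊 g) →
                         ∀ k → 1 ≤ k → ∀ n → 1 ≤ n → + (2 * n) ∣ Φ₂ (λ m → + ψ Σ𝕊 g fin (k * m)) n
  Φ₂-iterate-divisible g g-odd fin k@(suc _) _ =
    Φ₂-odd-map-divisible (symmetricSet Σ𝕊) (iter g k) (iter-commute g g-odd k) E _ ψ≡length
    where
    E : ∀ m → 1 ≤ m → Enumeration (Antiperiodic (iter g k) negS m)
    E m@(suc _) _ = enumeration-⇔ (antiperiodic-iter g negS k m)
                                  (solutions⇒enumeration Σ𝕊 (fin (k * m) (s≤s z≤n)))

    ψ≡length : ∀ m (1≤m : 1 ≤ m) → ψ Σ𝕊 g fin (k * m) ≡ length (Enumeration.elements (E m 1≤m))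
    ψ≡length (suc _) (s≤s z≤n) = refl

  Φ₂-product-divisible : ∀ j (gs : Fin j → S → S) → (∀ i → Odd Σ𝕊 (gs i)) →
                         (fins : ∀ i → FinitelyManySolutions Σ𝕊 (gs i)) → ∀ n → 1 ≤ n →
                         + (2 * n) ∣ Φ₂ (λ m → + product (map (λ i → ψ Σ𝕊 (gs i) (fins i) m) (allFin j))) n
  Φ₂-product-divisible j gs gs-odd fins =
    Φ₂-odd-map-divisible (Vec-symmetricSet (symmetricSet Σ𝕊) j) (pointwise gs)
                         (pointwise-commute gs negS gs-odd) E _ ψ≡length
    where
    E : ∀ m → 1 ≤ m → Enumeration (Antiperiodic (pointwise gs) (Vec.map negS) m)
    E m 1≤m = enumeration-⇔ (antiperiodic-pointwise gs negS m)
                            (enumeration-Π (λ i → solutions⇒enumeration Σ𝕊 (fins i m 1≤m)))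

    ψ≡length : ∀ m (1≤m : 1 ≤ m) →
               product (map (λ i → ψ Σ𝕊 (gs i) (fins i) m) (allFin j)) ≡ length (Enumeration.elements (E m 1≤m))
    ψ≡length (suc m) (s≤s z≤n) = trans (cong product (map-tabulate id (λ i → ψ Σ𝕊 (gs i) (fins i) (suc m))))
                                       (sym (length-vecProduct (λ i → Solutions.sols (fins i (suc m) (s≤s z≤n)))))

theorem3 : ∀ {a b} (Σ𝕊 : SymmetricSubset a b)
    → (g : SymmetricSubset.S Σ𝕊 → SymmetricSubset.S Σ𝕊)
    → Odd Σ𝕊 g
    → (fin : FinitelyManySolutions Σ𝕊 g)
    → (j : ℕ) → 1 ≤ j
    → (gs : Fin j → SymmetricSubset.S Σ𝕊 → SymmetricSubset.S Σ𝕊)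
    → (∀ i → Odd Σ𝕊 (gs i))
    → (fins : ∀ i → FinitelyManySolutions Σ𝕊 (gs i))
    → ((k : ℕ) → 1 ≤ k → IsOdd k
         → (n : ℕ) → 1 ≤ n
         → (+ (2 * n)) ∣ Φ₂ (λ m → + ψ Σ𝕊 g fin (k * m)) n)
      × ((n : ℕ) → 1 ≤ n
         → (+ (2 * n)) ∣ Φ₂ (λ m → + product (map (λ i → ψ Σ𝕊 (gs i) (fins i) m) (allFin j))) n)
theorem3 Σ𝕊 g g-odd fin j _ gs gs-odd fins =
  (λ k 1≤k _ → Φ₂-iterate-divisible Σ𝕊 g g-odd fin k 1≤k) , Φ₂-product-divisible Σ𝕊 j gs gs-odd fins
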